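{- Let $(G,s,t)$ be a minimal weak link, and suppose a vertex $b\in B_s$ is adjacent to every centre vertex. Then every centre vertex is adjacent to at least one vertex of $B_t\setminus\Gamma(b)$.
   Context: A Shannon game (link) $(G,s,t)$ consists of a finite simple graph $G$ and two distinct designated vertices $s,t$, the terminals. Two players, Short and Cut, alternately select a not-yet-selected non-terminal vertex; Short claims his vertices, Cut deletes his. Short wins if at the end there is an $s$–$t$ path all of whose internal vertices are claimed by Short; otherwise Cut wins. The link is strong if Short has a winning strategy when moving second, and weak if Short has a winning strategy when moving first but not when moving second. A weak link is minimal if deleting any single edge produces a game in which Short has no winning strategy as first player. The borders are $B_s=\Gamma(s)$ and $B_t=\Gamma(t)$; the centre is the set of vertices that are neither terminals nor in $B_s\cup B_t$. -}

module Defs where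

open import Data.Nat using (ℕ; zero; suc)
open import Data.Fin using (Fin; _≟_)
open import Data.Bool using (Bool; true; false; _∧_; _∨_; not)
open import Data.Product using (Σ; _×_; ∃; ∃-syntax; _,_)
open import Data.Sum using (_⊎_)
open import Data.Empty using (⊥)
open import Relation.Nullary using (¬_)
open import Relation.Nullary.Decidable using (⌊_⌋)
open import Relation.Binary.PropositionalEquality using (_≡_; _≢_)

Adj : ℕ → Set
Adj n = Fin n → Fin n → Bool

record Graph (n : ℕ) : Set where
  field
    adj    : Adj n
    sym    : ∀ x y → adj x y ≡ adj y x
    irrefl : ∀ x → adj x x ≡ false
open Graph public

deleteEdge : ∀ {n} → Adj n → Fin n → Fin n → Adj n
deleteEdge E u v x y =
  E x y ∧ not ((⌊ x ≟ u ⌋ ∧ ⌊ y ≟ v ⌋) ∨ (⌊ x ≟ v ⌋ ∧ ⌊ y ≟ u ⌋))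

data Status : Set where
  free short cut : Status

-- A position: the status of every vertex (terminals stay 'free' and are
-- never selectable).
Position : ℕ → Set
Position n = Fin n → Status

initial : ∀ {n} → Position n
initial _ = free

set : ∀ {n} → Position n → Fin n → Status → Position n
set σ v a x with x ≟ v
... | Relation.Nullary.yes _ = a
... | Relation.Nullary.no  _ = σ x

module Game {n : ℕ} (E : Adj n) (s t : Fin n) where

  Selectable : Position n → Fin n → Set
  Selectable σ v = (v ≢ s) × (v ≢ t) × (σ v ≡ free)

  NoMoves : Position n → Set
  NoMoves σ = ∀ v → ¬ Selectable σ v

  -- PathToT σ x : there is a walk x = v₀, v₁, …, vₖ = t in E with k ≥ 1
  -- whose internal vertices v₁ … vₖ₋₁ are all claimed by Short.
  -- (Such a walk exists iff such a path exists.)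
  data PathToT (σ : Position n) : Fin n → Set where
    edge : ∀ {x} → E x t ≡ true → PathToT σ x
    step : ∀ {x y} → E x y ≡ true → σ y ≡ short → PathToT σ y → PathToT σ x

  ShortWon : Position n → Set
  ShortWon σ = PathToT σ s

  ShortToMoveWins : ℕ → Position n → Set
  CutToMoveWins   : ℕ → Position n → Set

  ShortToMoveWins zero    σ = ⊥
  ShortToMoveWins (suc k) σ =
    (NoMoves σ × ShortWon σ)
    ⊎ (∃[ v ] (Selectable σ v × CutToMoveWins k (set σ v short)))

  CutToMoveWins zero    σ = ⊥
  CutToMoveWins (suc k) σ =
    (NoMoves σ → ShortWon σ)
    × (∀ v → Selectable σ v → ShortToMoveWins k (set σ v cut))

  -- The fuel n exceeds the number of non-terminal vertices (≤ n ∸ 2), so it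
  -- never runs out before the game ends.
  ShortWinsFirst : Set
  ShortWinsFirst = ShortToMoveWins (suc n) initial

  ShortWinsSecond : Set
  ShortWinsSecond = CutToMoveWins (suc n) initial

StrongLink : ∀ {n} → Graph n → Fin n → Fin n → Set
StrongLink G s t = Game.ShortWinsSecond (adj G) s t

WeakLink : ∀ {n} → Graph n → Fin n → Fin n → Set
WeakLink G s t = Game.ShortWinsFirst (adj G) s t × ¬ Game.ShortWinsSecond (adj G) s t

MinimalWeakLink : ∀ {n} → Graph n → Fin n → Fin n → Set
MinimalWeakLink G s t =
  WeakLink G s t
  × (∀ u v → adj G u v ≡ true →
       ¬ Game.ShortWinsFirst (deleteEdge (adj G) u v) s t)

InΓ : ∀ {n} → Graph n → Fin n → Fin n → Set
InΓ G x v = adj G x v ≡ true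

Centre : ∀ {n} → Graph n → Fin n → Fin n → Fin n → Set
Centre G s t v = (v ≢ s) × (v ≢ t) × ¬ InΓ G s v × ¬ InΓ G t v

-- Suppose some centre vertex c had all its B_t-neighbours in Γ(b). Then every
-- neighbour of c other than b lies in Γ(s) ∪ Γ(b), since centre neighbours are in Γ(b)
-- by hypothesis. Deleting the edge bc therefore cannot hurt Short: a winning walk
-- s … b c z … is shortened to s … b z … or s z …, and one using c b is shortened to
-- s b …. So Short still wins as first player after the deletion, contradicting minimality.
module Submission where

open import Defs hiding (sym)
open import Data.Nat using (ℕ; suc)
open import Data.Fin using (Fin; _≟_)
open import Data.Fin.Properties using (any?)
open import Data.Bool using (true; _∧_; not)
open import Data.Bool.Properties using () renaming (_≟_ to _≟ᵇ_)
open import Data.Product using (_×_; ∃-syntax; _,_)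
open import Data.Sum using (_⊎_; inj₁; inj₂; reduce; map; swap)
open import Data.Empty using (⊥-elim)
open import Relation.Nullary using (¬_; Dec; yes; no)
open import Relation.Nullary.Decidable using (⌊_⌋; isYes≗does; decidable-stable; _×-dec_; _⊎-dec_; ¬?)
open import Relation.Binary.PropositionalEquality using (_≡_; _≢_; refl; sym; trans)

private variable n : ℕ

SameEdge : Fin n → Fin n → Fin n → Fin n → Set
SameEdge u v x y = (x ≡ u × y ≡ v) ⊎ (x ≡ v × y ≡ u)

sameEdge? : (u v x y : Fin n) → Dec (SameEdge u v x y)
sameEdge? u v x y = (x ≟ u ×-dec y ≟ v) ⊎-dec (x ≟ v ×-dec y ≟ u)

¬SameEdge-endpoint : ∀ {u v x y : Fin n} → y ≢ u → y ≢ v → ¬ SameEdge u v x y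
¬SameEdge-endpoint y≢u y≢v (inj₁ (_ , y≡v)) = y≢v y≡v
¬SameEdge-endpoint y≢u y≢v (inj₂ (_ , y≡u)) = y≢u y≡u

module _ (E : Adj n) (u v x y : Fin n) where

  deleteEdge-≡ : deleteEdge E u v x y ≡ E x y ∧ not ⌊ sameEdge? u v x y ⌋
  deleteEdge-≡ rewrite isYes≗does (x ≟ u) | isYes≗does (y ≟ v)
                     | isYes≗does (x ≟ v) | isYes≗does (y ≟ u)
                     | isYes≗does (sameEdge? u v x y) = refl

  deleteEdge⇒ : deleteEdge E u v x y ≡ true → E x y ≡ true × ¬ SameEdge u v x y
  deleteEdge⇒ e rewrite deleteEdge-≡ with E x y | sameEdge? u v x y
  ... | true | no ¬same = refl , ¬same

  ⇒deleteEdge : E x y ≡ true → ¬ SameEdge u v x y → deleteEdge E u v x y ≡ true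
  ⇒deleteEdge e ¬same rewrite deleteEdge-≡ with E x y | sameEdge? u v x y
  ... | true | no _     = refl
  ... | _    | yes same = ⊥-elim (¬same same)

module _ {E E′ : Adj n} {s t : Fin n} where
  private
    module G  = Game E s t
    module G′ = Game E′ s t

  module _ (won : ∀ {σ} → G.ShortWon σ → G′.ShortWon σ) where

    ShortToMoveWins-mono : ∀ k σ → G.ShortToMoveWins k σ → G′.ShortToMoveWins k σ
    CutToMoveWins-mono   : ∀ k σ → G.CutToMoveWins k σ → G′.CutToMoveWins k σ

    ShortToMoveWins-mono (suc k) σ (inj₁ (over , w)) = inj₁ (over , won w)
    ShortToMoveWins-mono (suc k) σ (inj₂ (v , sel , r)) =
      inj₂ (v , sel , CutToMoveWins-mono k (set σ v short) r)
    CutToMoveWins-mono (suc k) σ (w , r) =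
      (λ over → won (w over)) , (λ v sel → ShortToMoveWins-mono k (set σ v cut) (r v sel))

    ShortWinsFirst-mono : G.ShortWinsFirst → G′.ShortWinsFirst
    ShortWinsFirst-mono = ShortToMoveWins-mono (suc n) initial

module PathToT-Properties (E : Adj n) (s t : Fin n) where
  open Game E s t

  Onward : Position n → Fin n → Set
  Onward σ y = y ≡ t ⊎ (σ y ≡ short × PathToT σ y)

  firstStep : ∀ {σ x} → PathToT σ x → ∃[ y ] (E x y ≡ true × Onward σ y)
  firstStep (edge e)      = _ , e , inj₁ refl
  firstStep (step e sh p) = _ , e , inj₂ (sh , p)

  prepend : ∀ {σ x y} → E x y ≡ true → Onward σ y → PathToT σ x
  prepend e (inj₁ refl)     = edge e
  prepend e (inj₂ (sh , p)) = step e sh p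

adj-irreflexive : (G : Graph n) {x y : Fin n} → adj G x y ≡ true → x ≢ y
adj-irreflexive G {x} xy refl with trans (sym xy) (irrefl G x)
... | ()

module DeleteEdge (G : Graph n) (s t u v : Fin n)
  (su : adj G s u ≡ true) (v≢s : v ≢ s) (v≢t : v ≢ t)
  (reroutable : ∀ z → adj G v z ≡ true → z ≢ u → adj G s z ≡ true ⊎ adj G u z ≡ true)
  where

  private
    E  = adj G
    E′ = deleteEdge E u v
    module G  = Game E s t
    module G′ = Game E′ s t
    open PathToT-Properties E′ s t

  avoiding : ∀ {x z} → E v z ≡ true → z ≢ u → E x z ≡ true → E′ x z ≡ true
  avoiding vz z≢u xz = ⇒deleteEdge E u v _ _ xz
    (¬SameEdge-endpoint z≢u (λ z≡v → adj-irreflexive G vz (sym z≡v)))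

  reroute : ∀ {σ} → G′.PathToT σ v → G′.PathToT σ u ⊎ G′.PathToT σ s
  reroute p with firstStep p
  ... | z , vz′ , onward with deleteEdge⇒ E u v v z vz′
  ... | vz , ¬same = swap (map via via (reroutable z vz z≢u))
    where
    z≢u : z ≢ u
    z≢u z≡u = ¬same (inj₂ (refl , z≡u))
    via : ∀ {x} → E x z ≡ true → G′.PathToT _ x
    via xz = prepend (avoiding vz z≢u xz) onward

  transferEdge : ∀ {σ x y} → E x y ≡ true → Onward σ y → G′.PathToT σ x ⊎ G′.PathToT σ s
  transferEdge {x = x} {y} xy onward with sameEdge? u v x y
  ... | no ¬same                 = inj₁ (prepend (⇒deleteEdge E u v x y xy ¬same) onward)
  ... | yes (inj₁ (refl , refl)) = reroute (onward-v onward)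
    where
    onward-v : ∀ {σ} → Onward σ v → G′.PathToT σ v
    onward-v (inj₁ v≡t)     = ⊥-elim (v≢t v≡t)
    onward-v (inj₂ (_ , p)) = p
  ... | yes (inj₂ (refl , refl)) = inj₂ (prepend (⇒deleteEdge E u v s u su ¬same) onward)
    where
    ¬same : ¬ SameEdge u v s u
    ¬same (inj₁ (s≡u , _)) = adj-irreflexive G su s≡u
    ¬same (inj₂ (s≡v , _)) = v≢s (sym s≡v)

  PathToT-transfer : ∀ {σ x} → G.PathToT σ x → G′.PathToT σ x ⊎ G′.PathToT σ s
  PathToT-transfer (G.edge xt) = transferEdge xt (inj₁ refl)
  PathToT-transfer (G.step xy sh p) with PathToT-transfer p
  ... | inj₁ q = transferEdge xy (inj₂ (sh , q))
  ... | inj₂ q = inj₂ q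

  ShortWon-deleteEdge : ∀ {σ} → G.ShortWon σ → G′.ShortWon σ
  ShortWon-deleteEdge p = reduce (PathToT-transfer p)

  ShortWinsFirst-deleteEdge : G.ShortWinsFirst → G′.ShortWinsFirst
  ShortWinsFirst-deleteEdge = ShortWinsFirst-mono ShortWon-deleteEdge

centre-neighbour : (G : Graph n) {s t c z : Fin n} → Centre G s t c → adj G c z ≡ true →
                   InΓ G s z ⊎ InΓ G t z ⊎ Centre G s t z
centre-neighbour G {s} {t} {c} {z} (_ , _ , ¬sc , ¬tc) cz
  with adj G s z ≟ᵇ true | adj G t z ≟ᵇ true
... | yes sz  | _       = inj₁ sz
... | no _    | yes tz  = inj₂ (inj₁ tz)
... | no ¬sz  | no ¬tz  = inj₂ (inj₂ (z≢s , z≢t , ¬sz , ¬tz))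
  where
  z≢s : z ≢ s
  z≢s refl = ¬sc (trans (Graph.sym G s c) cz)
  z≢t : z ≢ t
  z≢t refl = ¬tc (trans (Graph.sym G t c) cz)

lemma7 : ∀ {n} (G : Graph n) (s t : Fin n) → s ≢ t →
    MinimalWeakLink G s t →
    (b : Fin n) → InΓ G s b →
    (∀ c → Centre G s t c → InΓ G b c) →
    ∀ c → Centre G s t c →
      ∃[ w ] (InΓ G t w × ¬ InΓ G b w × InΓ G c w)
lemma7 G s t _ ((first , _) , minimal) b sb b-centre c c-centre@(c≢s , c≢t , _ , _)
  with any? (λ w → adj G t w ≟ᵇ true ×-dec ¬? (adj G b w ≟ᵇ true) ×-dec adj G c w ≟ᵇ true)
... | yes witness = witness
... | no none = ⊥-elim (minimal b c (b-centre c c-centre)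
                  (DeleteEdge.ShortWinsFirst-deleteEdge G s t b c sb c≢s c≢t reroutable first))
  where
  reroutable : ∀ z → adj G c z ≡ true → z ≢ b → adj G s z ≡ true ⊎ adj G b z ≡ true
  reroutable z cz _ with centre-neighbour G c-centre cz
  ... | inj₁ sz              = inj₁ sz
  ... | inj₂ (inj₁ tz)       = inj₂ (decidable-stable (adj G b z ≟ᵇ true) (λ ¬bz → none (z , tz , ¬bz , cz)))
  ... | inj₂ (inj₂ z-centre) = inj₂ (b-centre z z-centre)
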